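{- For all sufficiently large $n$, there exists a good base $\mathcal{R}$ over $n$-bit strings of size $m=O(n^3)$ and real polynomials $q_{(r,i,s)}:\{0,1\}^m\to\mathbb{R}$, for $r\in\mathcal{R}$, $i\in[n]$ and $s\in\{0,1\}^{\le n-i+1}$, each of degree at most $4$, such that $$\Pr_{r\leftarrow\mathcal{R}}\Big[\exists i\in[n],\ x\in\{0,1\}^n,\ s\in\{0,1\}^{\le n-i+1}:\ \big|q_{(r,i,s)}(\mathcal{Y}(r,x))-\phi_{i,s}(x)\big|>\tfrac16\Big]<\frac13,$$ where $r$ is drawn uniformly from $\mathcal{R}$.
   Context: For $\tau\in\{0,1\}^n$ let $\mathcal{R}^\tau=\{v\in\{0,1\}^n: v_k=0 \text{ for every } k \text{ with } \tau_k=0\}$. Let $\mathbf{1}_j\in\{0,1\}^n$ be the string with a 1 in position $j$ and 0 elsewhere. A good base of size $m=n+m'$ is a set of the form $\mathcal{R}=\{\mathbf{1}_1\}\times\cdots\times\{\mathbf{1}_n\}\times\mathcal{R}^{\tau^{(1)}}\times\cdots\times\mathcal{R}^{\tau^{(m')}}$ for some templates $\tau^{(1)},\dots,\tau^{(m')}\in\{0,1\}^n$; an element is an $m$-tuple $r=(r_1,\dots,r_m)$ of $n$-bit strings, and sampling $r$ uniformly means each $r_{n+j}$ is uniform on $\mathcal{R}^{\tau^{(j)}}$, independently. For $r\in\mathcal{R}$, $x\in\{0,1\}^n$, $\mathcal{Y}(r,x)\in\{0,1\}^m$ has $\mathcal{Y}(r,x)_j=\langle r_j,x\rangle\bmod 2$.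 Let $[n]=\{1,\dots,n\}$ and $\{0,1\}^{\le k}=\bigcup_{j=0}^k\{0,1\}^j$. For $i\in[n]$, $s\in\{0,1\}^{\le n-i+1}$, $x\in\{0,1\}^n$: $\phi_{i,s}(x)=1$ if $x_{i+k-1}=s_k$ for all $1\le k\le|s|$, and $\phi_{i,s}(x)=0$ otherwise. -}

module Defs where

open import Data.Bool using (Bool; true; false; _∧_; _xor_; not; if_then_else_)
open import Data.Nat using (ℕ; zero; suc; _+_; _*_; _∸_; _^_; _≤_; _<_)
open import Data.Fin as Fin using (Fin; toℕ)
open import Data.Fin.Properties using () renaming (_≟_ to _≟ᶠ_)
open import Data.Vec as Vec using (Vec; []; _∷_; lookup; tabulate; toList)
open import Data.List as List using (List; length; drop)
open import Data.List.Relation.Unary.All using (All)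
open import Data.Product using (Σ; _×_; proj₁; proj₂)
open import Data.Integer using (+_)
open import Data.Rational using (ℚ; 0ℚ; 1ℚ; ∣_∣; _/_) renaming (_+_ to _+ℚ_; _*_ to _*ℚ_; _-_ to _-ℚ_; _<_ to _<ℚ_)
open import Relation.Nullary.Decidable using (does)
open import Relation.Binary.PropositionalEquality using (_≡_)

-- n-bit strings; position k (1-indexed in the paper) is index k-1 here.
Bits : ℕ → Set
Bits n = Vec Bool n

InR : {n : ℕ} → Bits n → Bits n → Set
InR {n} τ v = (k : Fin n) → lookup τ k ≡ false → lookup v k ≡ false

unit : {n : ℕ} → Fin n → Bits n
unit j = tabulate (λ k → does (k ≟ᶠ j))

-- r ∈ R = {1_1}×…×{1_n}×R^{τ(1)}×…×R^{τ(m')}, with templates ts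
InBase : {n m' : ℕ} → Vec (Bits n) m' → Vec (Bits n) (n + m') → Set
InBase {n} {m'} ts r =
  ((j : Fin n) → lookup r (j Fin.↑ˡ m') ≡ unit j) ×
  ((j : Fin m') → InR (lookup ts j) (lookup r (n Fin.↑ʳ j)))

ones : {n : ℕ} → Bits n → ℕ
ones [] = 0
ones (true ∷ v) = suc (ones v)
ones (false ∷ v) = ones v

-- |R| = ∏_j |R^{τ(j)}| = ∏_j 2^{ones τ(j)}
baseSize : {n m' : ℕ} → Vec (Bits n) m' → ℕ
baseSize [] = 1
baseSize (τ ∷ ts) = 2 ^ ones τ * baseSize ts

dot : {n : ℕ} → Bits n → Bits n → Bool
dot [] [] = false
dot (a ∷ u) (b ∷ v) = (a ∧ b) xor dot u v

Y : {n m : ℕ} → Vec (Bits n) m → Bits n → Bits m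
Y r x = Vec.map (λ rj → dot rj x) r

-- polynomials in m variables: list of (coefficient, monomial),
-- a monomial being a list of variable indices (repetition allowed)
Poly : ℕ → Set
Poly m = List (ℚ × List (Fin m))

DegLE4 : {m : ℕ} → Poly m → Set
DegLE4 p = All (λ t → length (proj₂ t) ≤ 4) p

bitℚ : Bool → ℚ
bitℚ b = if b then 1ℚ else 0ℚ

evalMono : {m : ℕ} → Bits m → List (Fin m) → ℚ
evalMono y js = List.foldr (λ j acc → bitℚ (lookup y j) *ℚ acc) 1ℚ js

evalPoly : {m : ℕ} → Poly m → Bits m → ℚ
evalPoly p y = List.foldr (λ t acc → (proj₁ t *ℚ evalMono y (proj₂ t)) +ℚ acc) 0ℚ p

prefixB : List Bool → List Bool → Bool
prefixB List.[] _ = true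
prefixB (b List.∷ s) List.[] = false
prefixB (b List.∷ s) (c List.∷ t) = not (b xor c) ∧ prefixB s t

-- φ_{i,s}(x), with i0 = i - 1 (0-indexed start): x_{i+k-1} = s_k for k ≤ |s|
phi : {n : ℕ} → Bits n → ℕ → List Bool → Bool
phi x i0 s = prefixB s (drop i0 (toList x))

-- the bad event for r: ∃ i ∈ [n] (as Fin n, i = toℕ i0 + 1), x, s with |s| ≤ n - i + 1,
-- |q_{(r,i,s)}(Y(r,x)) - φ_{i,s}(x)| > 1/6
Bad : {n m' : ℕ} →
      (Vec (Bits n) (n + m') → Fin n → List Bool → Poly (n + m')) →
      Vec (Bits n) (n + m') → Set
Bad {n} q r =
  Σ (Fin n) λ i → Σ (Bits n) λ x → Σ (List Bool) λ s →
    (length s ≤ n ∸ toℕ i) ×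
    ((+ 1 / 6) <ℚ ∣ evalPoly (q r i s) (Y r x) -ℚ bitℚ (phi x (toℕ i) s) ∣)

-- For every window of positions [i, i+ℓ) the base contains M = 12t copies (t = 13n) of the window's
-- indicator as template. The affine polynomial q_{r,i,s} = 1 - (1/6t) · #{copies j : y_j ⊕ ⟨r_j, s⟩ = 1}
-- reads, on y = Y(r, x), the number of copies with ⟨r_j, x ⊕ s⟩ = 1. If x agrees with s on the window,
-- all of these vanish and q = 1 = φ_{i,s}(x). Otherwise they are independent unbiased bits, and q is
-- within 1/6 of φ_{i,s}(x) = 0 unless their count c leaves [5t, 7t]. Markov's inequality for the
-- exponential moments 5^c 7^{M-c} and 7^c 5^{M-c}, both of mean 6^M, bounds the probability of that by
-- 2 (6^12 / 5^5 7^7)^t, and a union bound over the n(n+1) windows and the 2^n values of x ⊕ s keeps the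
-- total below 1/3 once n ≥ 4. Probabilities are counts over an explicit enumeration of the base.

{-# OPTIONS --safe #-}
module Submission where

open import Algebra.Bundles using (CommutativeRing)
open import Data.Bool using (Bool; true; false; _∧_; _∨_; not; _xor_; if_then_else_; T)
open import Data.Bool.ListAction using (any)
open import Data.Bool.Properties using (T-∧; T-∨; ∧-distribˡ-xor; xor-∧-commutativeRing; xor-identityʳ; xor-comm)
open import Data.Empty using (⊥-elim)
open import Data.Fin using (Fin; zero; suc; toℕ; _↑ˡ_; _↑ʳ_; combine; quotient; remainder)
open import Data.Fin.Properties using (remQuot-combine; toℕ-fromℕ<) renaming (_≟_ to _≟ᶠ_)
import Data.Integer as ℤ
open import Data.List using (List; []; _∷_; _++_; map; length; filterᵇ; cartesianProductWith; allFin)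
open import Data.List.Properties using (map-++; map-cong; map-∘; length-++; length-map; length-tabulate)
open import Data.List.Membership.Propositional using (_∈_; lose)
open import Data.List.Membership.Propositional.Properties
  using (∈-cartesianProductWith⁺; ∈-++⁺ˡ; ∈-++⁺ʳ; ∈-map⁺; ∈-allFin; ∈-filter⁺)
open import Data.List.Relation.Unary.All using ([]; _∷_)
open import Data.List.Relation.Unary.All.Properties using (++⁺)
open import Data.List.Relation.Unary.Any using (here)
open import Data.List.Relation.Unary.Any.Properties using (any⁺)
open import Data.Nat using (ℕ; zero; suc; _+_; _*_; _^_; _∸_; _≤_; _<_; _<ᵇ_; z≤n; s≤s; NonZero; >-nonZero; >-nonZero⁻¹)
open import Data.Nat.DivMod using (_mod_; m%n<n; m≤n⇒m%n≡m)
open import Data.Nat.ListAction using (sum)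
open import Data.Nat.ListAction.Properties using (sum-++)
open import Data.Nat.Properties
open import Data.Nat.Tactic.RingSolver using (solve-∀)
open import Data.Product using (Σ; _×_; _,_; proj₁; proj₂)
open import Data.Rational using (ℚ; 0ℚ; 1ℚ; -_; ∣_∣; _/_; 1/_; NonNegative; Positive)
  renaming (_+_ to _+ℚ_; _*_ to _*ℚ_; _-_ to _-ℚ_; _≤_ to _≤ℚ_; _<_ to _<ℚ_)
import Data.Rational.Properties as ℚ
open import Data.Rational.Solver using (module +-*-Solver)
open import Data.Sum using (inj₁; inj₂)
open import Data.Vec as Vec using (Vec; []; _∷_; lookup; tabulate; replicate; zipWith; splitAt)
open import Data.Vec.Properties
  using (lookup∘tabulate; lookup-map; lookup-++ˡ; lookup-++ʳ; lookup-replicate; tabulate∘lookup; tabulate-cong)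
open import Function using (_∘_; Equivalence)
open import Relation.Binary.PropositionalEquality
open import Relation.Nullary using (¬_; yes; no)
open import Relation.Nullary.Decidable using (does; T?)

open import Algebra.Properties.CommutativeMonoid.Sum *-1-commutativeMonoid
  using () renaming (sum to ∏; sum-cong-≗ to ∏-cong; ∑-distrib-+ to ∏-distrib-*; sum-replicate-zero to ∏-one)
open import Algebra.Properties.CommutativeSemigroup *-commutativeSemigroup
  using (x∙yz≈y∙xz) renaming (interchange to *-interchange)
open import Algebra.Properties.CommutativeSemigroup +-commutativeSemigroup
  using () renaming (interchange to +-interchange)
open import Algebra.Properties.CommutativeSemigroup (CommutativeRing.+-commutativeSemigroup xor-∧-commutativeRing)
  using () renaming (interchange to xor-interchange)
open import Algebra.Properties.Group ℚ.+-0-group using () renaming (⁻¹-involutive to neg-involutive)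

open import Defs

private variable
  A B C : Set

∏-const : (m c : ℕ) → ∏ {m} (λ _ → c) ≡ c ^ m
∏-const zero c = refl
∏-const (suc m) c = cong (c *_) (∏-const m c)

∏-↑ : (m k : ℕ) (f : Fin (m + k) → ℕ) → ∏ f ≡ ∏ (f ∘ (_↑ˡ k)) * ∏ (f ∘ (m ↑ʳ_))
∏-↑ zero k f = sym (*-identityˡ (∏ f))
∏-↑ (suc m) k f = trans (cong (f zero *_) (∏-↑ m k (f ∘ suc))) (sym (*-assoc (f zero) _ _))

∏-combine : (K M : ℕ) (f : Fin (K * M) → ℕ) → ∏ f ≡ ∏ {K} (λ b → ∏ {M} (λ j → f (combine b j)))
∏-combine zero M f = refl
∏-combine (suc K) M f =
  trans (∏-↑ M (K * M) f) (cong (∏ (λ j → f (combine {suc K} zero j)) *_) (∏-combine K M (f ∘ (M ↑ʳ_))))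

∏-if : {m : ℕ} (c : Bool) (f : Fin m → ℕ) → ∏ (λ j → if c then f j else 1) ≡ (if c then ∏ f else 1)
∏-if true f = refl
∏-if {m} false f = ∏-one m

∏-at : {m : ℕ} (b : Fin m) (f : Fin m → ℕ) → ∏ (λ b' → if does (b' ≟ᶠ b) then f b' else 1) ≡ f b
∏-at {suc m} zero f = trans (cong (f zero *_) (∏-one m)) (*-identityʳ (f zero))
∏-at {suc m} (suc b) f = trans (*-identityˡ _) (trans (∏-cong drop-zero) (∏-at b (f ∘ suc)))
  where
  drop-zero : ∀ b' → (if does (suc b' ≟ᶠ suc b) then f (suc b') else 1) ≡ (if does (b' ≟ᶠ b) then f (suc b') else 1)
  drop-zero b' with b' ≟ᶠ b
  ... | yes _ = refl
  ... | no _ = refl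

count : {m : ℕ} → (Fin m → Bool) → ℕ
count {zero} g = 0
count {suc m} g = (if g zero then 1 else 0) + count (g ∘ suc)

count+count-not : {m : ℕ} (g : Fin m → Bool) → count g + count (not ∘ g) ≡ m
count+count-not {zero} g = refl
count+count-not {suc m} g with g zero
... | true = cong suc (count+count-not (g ∘ suc))
... | false = trans (+-suc (count (g ∘ suc)) _) (cong suc (count+count-not (g ∘ suc)))

∏-if-count : {m : ℕ} (g : Fin m → Bool) (α β : ℕ) →
  ∏ (λ j → if g j then α else β) ≡ α ^ count g * β ^ count (not ∘ g)
∏-if-count {zero} g α β = refl
∏-if-count {suc m} g α β with g zero
... | true = trans (cong (α *_) (∏-if-count (g ∘ suc) α β)) (sym (*-assoc α _ _))
... | false =
  trans (cong (β *_) (∏-if-count (g ∘ suc) α β)) (x∙yz≈y∙xz β (α ^ count (g ∘ suc)) (β ^ count (not ∘ g ∘ suc)))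

count-false : {m : ℕ} (g : Fin m → Bool) → (∀ j → g j ≡ false) → count g ≡ 0
count-false {zero} g _ = refl
count-false {suc m} g g≡false rewrite g≡false zero = count-false (g ∘ suc) (g≡false ∘ suc)

sum-map-++ : (f : A → ℕ) (xs ys : List A) → sum (map f (xs ++ ys)) ≡ sum (map f xs) + sum (map f ys)
sum-map-++ f xs ys = trans (cong sum (map-++ f xs ys)) (sum-++ (map f xs) (map f ys))

sum-map-cong : {f g : A → ℕ} → (∀ x → f x ≡ g x) → (xs : List A) → sum (map f xs) ≡ sum (map g xs)
sum-map-cong f≗g xs = cong sum (map-cong f≗g xs)

sum-map-+ : (f g : A → ℕ) (xs : List A) → sum (map (λ x → f x + g x) xs) ≡ sum (map f xs) + sum (map g xs)
sum-map-+ f g [] = refl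
sum-map-+ f g (x ∷ xs) = trans (cong (f x + g x +_) (sum-map-+ f g xs)) (+-interchange (f x) (g x) (sum (map f xs)) (sum (map g xs)))

sum-map-const : (c : ℕ) (xs : List A) → sum (map (λ _ → c) xs) ≡ c * length xs
sum-map-const c [] = sym (*-zeroʳ c)
sum-map-const c (x ∷ xs) = trans (cong (c +_) (sum-map-const c xs)) (sym (*-suc c (length xs)))

sum-map-*ʳ : (f : A → ℕ) (c : ℕ) (xs : List A) → sum (map (λ x → f x * c) xs) ≡ sum (map f xs) * c
sum-map-*ʳ f c [] = refl
sum-map-*ʳ f c (x ∷ xs) = trans (cong (f x * c +_) (sum-map-*ʳ f c xs)) (sym (*-distribʳ-+ c (f x) _))

sum-map-*ˡ : (c : ℕ) (f : A → ℕ) (xs : List A) → sum (map (λ x → c * f x) xs) ≡ c * sum (map f xs)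
sum-map-*ˡ c f [] = sym (*-zeroʳ c)
sum-map-*ˡ c f (x ∷ xs) = trans (cong (c * f x +_) (sum-map-*ˡ c f xs)) (sym (*-distribˡ-+ c (f x) _))

sum-map-≤ : (f : A → ℕ) {c : ℕ} (xs : List A) → (∀ x → f x ≤ c) → sum (map f xs) ≤ length xs * c
sum-map-≤ f [] f≤c = z≤n
sum-map-≤ f (x ∷ xs) f≤c = +-mono-≤ (f≤c x) (sum-map-≤ f xs f≤c)

length-filterᵇ-∨ : (f g : A → Bool) (xs : List A) →
  length (filterᵇ (λ x → f x ∨ g x) xs) ≤ length (filterᵇ f xs) + length (filterᵇ g xs)
length-filterᵇ-∨ f g [] = z≤n
length-filterᵇ-∨ f g (x ∷ xs) with f x | g x
... | true  | true  = s≤s (≤-trans (length-filterᵇ-∨ f g xs) (≤-trans (n≤1+n _) (≤-reflexive (sym (+-suc _ _)))))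
... | true  | false = s≤s (length-filterᵇ-∨ f g xs)
... | false | true  = ≤-trans (s≤s (length-filterᵇ-∨ f g xs)) (≤-reflexive (sym (+-suc _ _)))
... | false | false = length-filterᵇ-∨ f g xs

length-filterᵇ-any : (g : B → A → Bool) (ys : List B) (xs : List A) →
  length (filterᵇ (λ x → any (λ y → g y x) ys) xs) ≤ sum (map (λ y → length (filterᵇ (g y) xs)) ys)
length-filterᵇ-any g [] xs = ≤-reflexive (length-filterᵇ-false xs)
  where
  length-filterᵇ-false : (xs : List A) → length (filterᵇ (λ _ → false) xs) ≡ 0
  length-filterᵇ-false [] = refl
  length-filterᵇ-false (x ∷ xs) = length-filterᵇ-false xs
length-filterᵇ-any g (y ∷ ys) xs = ≤-trans (length-filterᵇ-∨ (g y) (λ x → any (λ y → g y x) ys) xs)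
  (+-monoʳ-≤ (length (filterᵇ (g y) xs)) (length-filterᵇ-any g ys xs))

length-filterᵇ-any-* : (g : B → A → Bool) (ys : List B) (xs : List A) {c bound : ℕ} →
  (∀ y → length (filterᵇ (g y) xs) * c ≤ bound) →
  length (filterᵇ (λ x → any (λ y → g y x) ys) xs) * c ≤ length ys * bound
length-filterᵇ-any-* g ys xs {c} {bound} each≤ = begin
  length (filterᵇ (λ x → any (λ y → g y x) ys) xs) * c      ≤⟨ *-monoˡ-≤ c (length-filterᵇ-any g ys xs) ⟩
  sum (map (λ y → length (filterᵇ (g y) xs)) ys) * c        ≡⟨ sum-map-*ʳ (λ y → length (filterᵇ (g y) xs)) c ys ⟨
  sum (map (λ y → length (filterᵇ (g y) xs) * c) ys)        ≤⟨ sum-map-≤ _ ys each≤ ⟩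
  length ys * bound                                          ∎
  where open ≤-Reasoning

length-filterᵇ-* : (f : A → Bool) (W : A → ℕ) {c : ℕ} (xs : List A) →
  (∀ x → T (f x) → c ≤ W x) → length (filterᵇ f xs) * c ≤ sum (map W xs)
length-filterᵇ-* f W [] c≤W = z≤n
length-filterᵇ-* f W (x ∷ xs) c≤W with f x in fx
... | true  = +-mono-≤ (c≤W x (subst T (sym fx) _)) (length-filterᵇ-* f W xs c≤W)
... | false = ≤-trans (length-filterᵇ-* f W xs c≤W) (m≤n+m _ (W x))

sum-map-cartesianProductWith : (_·_ : A → B → C) (h : C → ℕ) (f : A → ℕ) (g : B → ℕ) →
  (∀ a b → h (a · b) ≡ f a * g b) → (xs : List A) (ys : List B) →
  sum (map h (cartesianProductWith _·_ xs ys)) ≡ sum (map f xs) * sum (map g ys)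
sum-map-cartesianProductWith _·_ h f g h≡f*g [] ys = refl
sum-map-cartesianProductWith _·_ h f g h≡f*g (x ∷ xs) ys = begin
  sum (map h (map (x ·_) ys ++ cartesianProductWith _·_ xs ys))
    ≡⟨ sum-map-++ h (map (x ·_) ys) _ ⟩
  sum (map h (map (x ·_) ys)) + sum (map h (cartesianProductWith _·_ xs ys))
    ≡⟨ cong₂ _+_ row (sum-map-cartesianProductWith _·_ h f g h≡f*g xs ys) ⟩
  f x * sum (map g ys) + sum (map f xs) * sum (map g ys)
    ≡⟨ *-distribʳ-+ (sum (map g ys)) (f x) _ ⟨
  (f x + sum (map f xs)) * sum (map g ys) ∎
  where
  open ≡-Reasoning
  row : sum (map h (map (x ·_) ys)) ≡ f x * sum (map g ys)
  row = begin
    sum (map h (map (x ·_) ys))       ≡⟨ cong sum (map-∘ ys) ⟨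
    sum (map (h ∘ (x ·_)) ys)         ≡⟨ cong sum (map-cong (h≡f*g x) ys) ⟩
    sum (map (λ y → f x * g y) ys)    ≡⟨ sum-map-*ˡ (f x) g ys ⟩
    f x * sum (map g ys)              ∎

allVecs : {m : ℕ} → (Fin m → List A) → List (Vec A m)
allVecs {m = zero} Ls = [] ∷ []
allVecs {m = suc m} Ls = cartesianProductWith _∷_ (Ls zero) (allVecs (Ls ∘ suc))

∈-allVecs⁺ : {m : ℕ} (Ls : Fin m → List A) (v : Vec A m) → (∀ p → lookup v p ∈ Ls p) → v ∈ allVecs Ls
∈-allVecs⁺ Ls [] _ = here refl
∈-allVecs⁺ Ls (a ∷ v) v∈ = ∈-cartesianProductWith⁺ _∷_ (v∈ zero) (∈-allVecs⁺ (Ls ∘ suc) v (v∈ ∘ suc))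

sum-∏-allVecs : {m : ℕ} (w : Fin m → A → ℕ) (Ls : Fin m → List A) →
  sum (map (λ v → ∏ (λ p → w p (lookup v p))) (allVecs Ls)) ≡ ∏ (λ p → sum (map (w p) (Ls p)))
sum-∏-allVecs {m = zero} w Ls = refl
sum-∏-allVecs {m = suc m} w Ls =
  trans (sum-map-cartesianProductWith _∷_ _ (w zero) (λ v → ∏ (λ p → w (suc p) (lookup v p))) (λ _ _ → refl)
           (Ls zero) (allVecs (Ls ∘ suc)))
        (cong (sum (map (w zero) (Ls zero)) *_) (sum-∏-allVecs (w ∘ suc) (Ls ∘ suc)))

length-allVecs : {m : ℕ} (Ls : Fin m → List A) → length (allVecs Ls) ≡ ∏ (λ p → length (Ls p))
length-allVecs {m = zero} Ls = refl
length-allVecs {m = suc m} Ls =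
  trans (length-cartesianProductWith _∷_ (Ls zero) (allVecs (Ls ∘ suc))) (cong (length (Ls zero) *_) (length-allVecs (Ls ∘ suc)))
  where
  length-cartesianProductWith : (_·_ : A → B → C) (xs : List A) (ys : List B) →
    length (cartesianProductWith _·_ xs ys) ≡ length xs * length ys
  length-cartesianProductWith _·_ [] ys = refl
  length-cartesianProductWith _·_ (x ∷ xs) ys =
    trans (length-++ (map (x ·_) ys)) (cong₂ _+_ (length-map (x ·_) ys) (length-cartesianProductWith _·_ xs ys))

_⊕_ : {n : ℕ} → Bits n → Bits n → Bits n
_⊕_ = zipWith _xor_

dot-⊕ : {n : ℕ} (a x s : Bits n) → dot a (x ⊕ s) ≡ dot a x xor dot a s
dot-⊕ [] [] [] = refl
dot-⊕ (a ∷ as) (x ∷ xs) (s ∷ ss) =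
  trans (cong₂ _xor_ (∧-distribˡ-xor a x s) (dot-⊕ as xs ss)) (xor-interchange (a ∧ x) (a ∧ s) (dot as xs) (dot as ss))

meets : {n : ℕ} → Bits n → Bits n → Bool
meets [] [] = false
meets (b ∷ τ) (c ∷ z) = (b ∧ c) ∨ meets τ z

listR : {n : ℕ} → Bits n → List (Bits n)
listR [] = [] ∷ []
listR (true ∷ τ) = map (true ∷_) (listR τ) ++ map (false ∷_) (listR τ)
listR (false ∷ τ) = map (false ∷_) (listR τ)

InR-tail : {n : ℕ} {b c : Bool} {τ v : Bits n} → InR (b ∷ τ) (c ∷ v) → InR τ v
InR-tail v∈R k = v∈R (suc k)

∈-listR⁺ : {n : ℕ} (τ v : Bits n) → InR τ v → v ∈ listR τ
∈-listR⁺ [] [] _ = here refl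
∈-listR⁺ (true ∷ τ) (true ∷ v) v∈R = ∈-++⁺ˡ (∈-map⁺ (true ∷_) (∈-listR⁺ τ v (InR-tail v∈R)))
∈-listR⁺ (true ∷ τ) (false ∷ v) v∈R =
  ∈-++⁺ʳ (map (true ∷_) (listR τ)) (∈-map⁺ (false ∷_) (∈-listR⁺ τ v (InR-tail v∈R)))
∈-listR⁺ (false ∷ τ) (true ∷ v) v∈R with () ← v∈R zero refl
∈-listR⁺ (false ∷ τ) (false ∷ v) v∈R = ∈-map⁺ (false ∷_) (∈-listR⁺ τ v (InR-tail v∈R))

length-listR : {n : ℕ} (τ : Bits n) → length (listR τ) ≡ 2 ^ ones τ
length-listR [] = refl
length-listR (true ∷ τ) = begin
  length (map (true ∷_) (listR τ) ++ map (false ∷_) (listR τ)) ≡⟨ length-++ (map (true ∷_) (listR τ)) ⟩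
  length (map (true ∷_) (listR τ)) + length (map (false ∷_) (listR τ))
    ≡⟨ cong₂ _+_ (length-map _ (listR τ)) (length-map _ (listR τ)) ⟩
  length (listR τ) + length (listR τ) ≡⟨ cong₂ _+_ (length-listR τ) (trans (length-listR τ) (sym (+-identityʳ _))) ⟩
  2 ^ ones τ + (2 ^ ones τ + 0) ∎
  where open ≡-Reasoning
length-listR (false ∷ τ) = trans (length-map _ (listR τ)) (length-listR τ)

dot-disjoint : {n : ℕ} (τ a z : Bits n) → InR τ a → ¬ T (meets τ z) → dot a z ≡ false
dot-disjoint [] [] [] _ _ = refl
dot-disjoint (false ∷ τ) (true ∷ a) (c ∷ z) a∈R _ with () ← a∈R zero refl
dot-disjoint (false ∷ τ) (false ∷ a) (c ∷ z) a∈R τ∩z=∅ = dot-disjoint τ a z (InR-tail a∈R) τ∩z=∅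
dot-disjoint (true ∷ τ) a (true ∷ z) _ τ∩z=∅ = ⊥-elim (τ∩z=∅ _)
dot-disjoint (true ∷ τ) (true ∷ a) (false ∷ z) a∈R τ∩z=∅ = dot-disjoint τ a z (InR-tail a∈R) τ∩z=∅
dot-disjoint (true ∷ τ) (false ∷ a) (false ∷ z) a∈R τ∩z=∅ = dot-disjoint τ a z (InR-tail a∈R) τ∩z=∅

length-map-++-map : {n : ℕ} {A : Set} (g h : A → Bits n) (E : List A) → length (map g E ++ map h E) ≡ length E + length E
length-map-++-map g h E = trans (length-++ (map g E)) (cong₂ _+_ (length-map g E) (length-map h E))

-- If τ and z share a 1, flipping that coordinate of a pairs up R^τ so that ⟨a,z⟩ is odd for exactly half of it.
sum-listR-balanced : {n : ℕ} (f : Bool → ℕ) (τ z : Bits n) → T (meets τ z) →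
  2 * sum (map (λ a → f (dot a z)) (listR τ)) ≡ (f true + f false) * length (listR τ)
sum-listR-balanced f [] [] ()
sum-listR-balanced f (true ∷ τ) (true ∷ z) _ = begin
  2 * sum (map F (map (true ∷_) E ++ map (false ∷_) E))
    ≡⟨ cong (2 *_) (sum-map-++ F (map (true ∷_) E) _) ⟩
  2 * (sum (map F (map (true ∷_) E)) + sum (map F (map (false ∷_) E)))
    ≡⟨ cong (2 *_) (cong₂ _+_ (cong sum (map-∘ E)) (cong sum (map-∘ E))) ⟨
  2 * (sum (map (λ a → f (not (dot a z))) E) + sum (map (λ a → f (dot a z)) E))
    ≡⟨ cong (2 *_) (sum-map-+ _ _ E) ⟨
  2 * sum (map (λ a → f (not (dot a z)) + f (dot a z)) E)
    ≡⟨ cong (2 *_) (sum-map-cong (λ a → pair (dot a z)) E) ⟩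
  2 * sum (map (λ _ → c) E)
    ≡⟨ cong (2 *_) (sum-map-const c E) ⟩
  2 * (c * length E)
    ≡⟨ double c (length E) ⟩
  c * (length E + length E)
    ≡⟨ cong (c *_) (length-map-++-map (true ∷_) (false ∷_) E) ⟨
  c * length (map (true ∷_) E ++ map (false ∷_) E) ∎
  where
  open ≡-Reasoning
  E = listR τ
  c = f true + f false
  F = λ a → f (dot a (true ∷ z))
  pair : ∀ b → f (not b) + f b ≡ c
  pair true = +-comm (f false) (f true)
  pair false = refl
  double : ∀ c l → 2 * (c * l) ≡ c * (l + l)
  double = solve-∀
sum-listR-balanced f (true ∷ τ) (false ∷ z) τ∩z≠∅ = begin
  2 * sum (map F (map (true ∷_) E ++ map (false ∷_) E))
    ≡⟨ cong (2 *_) (sum-map-++ F (map (true ∷_) E) _) ⟩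
  2 * (sum (map F (map (true ∷_) E)) + sum (map F (map (false ∷_) E)))
    ≡⟨ cong (2 *_) (cong₂ _+_ (cong sum (map-∘ E)) (cong sum (map-∘ E))) ⟨
  2 * (S + S)                    ≡⟨ *-distribˡ-+ 2 S S ⟩
  2 * S + 2 * S                  ≡⟨ cong₂ _+_ ih ih ⟩
  c * length E + c * length E    ≡⟨ *-distribˡ-+ c (length E) (length E) ⟨
  c * (length E + length E)      ≡⟨ cong (c *_) (length-map-++-map (true ∷_) (false ∷_) E) ⟨
  c * length (map (true ∷_) E ++ map (false ∷_) E) ∎
  where
  open ≡-Reasoning
  E = listR τ
  c = f true + f false
  F = λ a → f (dot a (false ∷ z))
  S = sum (map (λ a → f (dot a z)) E)
  ih = sum-listR-balanced f τ z τ∩z≠∅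
sum-listR-balanced f (false ∷ τ) (c ∷ z) τ∩z≠∅ = begin
  2 * sum (map (λ a → f (dot a (c ∷ z))) (map (false ∷_) E))
    ≡⟨ cong (λ s → 2 * sum s) (map-∘ E) ⟨
  2 * sum (map (λ a → f (dot a z)) E)
    ≡⟨ sum-listR-balanced f τ z τ∩z≠∅ ⟩
  (f true + f false) * length E
    ≡⟨ cong ((f true + f false) *_) (length-map (false ∷_) E) ⟨
  (f true + f false) * length (map (false ∷_) E) ∎
  where
  open ≡-Reasoning
  E = listR τ

window : (n i ℓ : ℕ) → Bits n
window zero _ _ = []
window (suc n) (suc i) ℓ = false ∷ window n i ℓ
window (suc n) zero zero = false ∷ window n zero zero
window (suc n) zero (suc ℓ) = true ∷ window n zero ℓ

placeAt : (n i : ℕ) → List Bool → Bits n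
placeAt zero _ _ = []
placeAt (suc n) (suc i) s = false ∷ placeAt n i s
placeAt (suc n) zero [] = false ∷ placeAt n zero []
placeAt (suc n) zero (c ∷ s) = c ∷ placeAt n zero s

meets-window-empty : {n : ℕ} (z : Bits n) → meets (window n zero zero) z ≡ false
meets-window-empty [] = refl
meets-window-empty (c ∷ z) = meets-window-empty z

phi-window : (n i : ℕ) (x : Bits n) (s : List Bool) → length s ≤ n ∸ i →
  phi x i s ≡ not (meets (window n i (length s)) (x ⊕ placeAt n i s))
phi-window zero i [] [] _ = refl
phi-window zero zero [] (c ∷ s) ()
phi-window zero (suc i) [] (c ∷ s) ()
phi-window (suc n) (suc i) (b ∷ x) s |s|≤ = phi-window n i x s |s|≤
phi-window (suc n) zero (b ∷ x) [] _ = cong not (sym (meets-window-empty (x ⊕ placeAt n zero [])))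
phi-window (suc n) zero (b ∷ x) (c ∷ s) (s≤s |s|≤) =
  trans (cong (not (c xor b) ∧_) (phi-window n zero x s |s|≤)) (agree b c _)
  where
  agree : ∀ b c N → (not (c xor b) ∧ not N) ≡ not ((b xor c) ∨ N)
  agree true true N = refl
  agree true false N = refl
  agree false true N = refl
  agree false false N = refl

toℚ : ℕ → ℚ
toℚ zero = 0ℚ
toℚ (suc c) = 1ℚ +ℚ toℚ c

toℚ-nonNeg : (c : ℕ) → NonNegative (toℚ c)
toℚ-nonNeg zero = _
toℚ-nonNeg (suc c) = ℚ.nonNeg+nonNeg⇒nonNeg 1ℚ (toℚ c) {{toℚ-nonNeg c}}

toℚ-pos : (c : ℕ) → Positive (toℚ (suc c))
toℚ-pos c = ℚ.pos+nonNeg⇒pos 1ℚ (toℚ c) {{toℚ-nonNeg c}}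

toℚ-+ : (a b : ℕ) → toℚ (a + b) ≡ toℚ a +ℚ toℚ b
toℚ-+ zero b = sym (ℚ.+-identityˡ (toℚ b))
toℚ-+ (suc a) b = trans (cong (1ℚ +ℚ_) (toℚ-+ a b)) (sym (ℚ.+-assoc 1ℚ (toℚ a) (toℚ b)))

toℚ-* : (a b : ℕ) → toℚ (a * b) ≡ toℚ a *ℚ toℚ b
toℚ-* zero b = sym (ℚ.*-zeroˡ (toℚ b))
toℚ-* (suc a) b = begin
  toℚ (b + a * b)             ≡⟨ toℚ-+ b (a * b) ⟩
  toℚ b +ℚ toℚ (a * b)        ≡⟨ cong (toℚ b +ℚ_) (toℚ-* a b) ⟩
  toℚ b +ℚ toℚ a *ℚ toℚ b     ≡⟨ solve 2 (λ x y → y :+ x :* y := (con 1ℚ :+ x) :* y) refl (toℚ a) (toℚ b) ⟩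
  (1ℚ +ℚ toℚ a) *ℚ toℚ b      ∎
  where
  open ≡-Reasoning
  open +-*-Solver

toℚ-mono-≤ : {a b : ℕ} → a ≤ b → toℚ a ≤ℚ toℚ b
toℚ-mono-≤ {b = b} z≤n = ℚ.nonNegative⁻¹ (toℚ b) {{toℚ-nonNeg b}}
toℚ-mono-≤ (s≤s a≤b) = ℚ.+-monoʳ-≤ 1ℚ (toℚ-mono-≤ a≤b)

-- The reciprocal 1/k, with the junk value 1/0 = 0.
recip : ℕ → ℚ
recip zero = 0ℚ
recip (suc k) = (1/ toℚ (suc k)) {{ℚ.pos⇒nonZero (toℚ (suc k)) {{toℚ-pos k}}}}

recip-nonNeg : (k : ℕ) → NonNegative (recip k)
recip-nonNeg zero = _
recip-nonNeg (suc k) = ℚ.pos⇒nonNeg (recip (suc k)) {{ℚ.1/pos⇒pos (toℚ (suc k)) {{toℚ-pos k}}}}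

recip-inverseˡ : (k : ℕ) .{{_ : NonZero k}} → recip k *ℚ toℚ k ≡ 1ℚ
recip-inverseˡ (suc k) = ℚ.*-inverseˡ (toℚ (suc k)) {{ℚ.pos⇒nonZero (toℚ (suc k)) {{toℚ-pos k}}}}

recip-6*-* : (t : ℕ) .{{_ : NonZero t}} → recip (6 * t) *ℚ toℚ t ≡ ℤ.+ 1 / 6
recip-6*-* t@(suc _) = begin
  recip (6 * t) *ℚ toℚ t
    ≡⟨ solve 2 (λ r x → r :* x := r :* (con (toℚ 6) :* x) :* con (ℤ.+ 1 / 6)) refl (recip (6 * t)) (toℚ t) ⟩
  recip (6 * t) *ℚ (toℚ 6 *ℚ toℚ t) *ℚ (ℤ.+ 1 / 6)
    ≡⟨ cong (λ x → recip (6 * t) *ℚ x *ℚ (ℤ.+ 1 / 6)) (toℚ-* 6 t) ⟨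
  recip (6 * t) *ℚ toℚ (6 * t) *ℚ (ℤ.+ 1 / 6)       ≡⟨ cong (_*ℚ (ℤ.+ 1 / 6)) (recip-inverseˡ (6 * t)) ⟩
  1ℚ *ℚ (ℤ.+ 1 / 6)                                 ≡⟨ ℚ.*-identityˡ (ℤ.+ 1 / 6) ⟩
  ℤ.+ 1 / 6                                         ∎
  where
  open ≡-Reasoning
  open +-*-Solver

-q≤p≤q⇒∣p∣≤q : {p q : ℚ} → - q ≤ℚ p → p ≤ℚ q → ∣ p ∣ ≤ℚ q
-q≤p≤q⇒∣p∣≤q {p} {q} -q≤p p≤q with ℚ.∣p∣≡p∨∣p∣≡-p p
... | inj₁ ∣p∣≡p = subst (_≤ℚ q) (sym ∣p∣≡p) p≤q
... | inj₂ ∣p∣≡-p = subst₂ _≤ℚ_ (sym ∣p∣≡-p) (neg-involutive q) (ℚ.neg-antimono-≤ -q≤p)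

∣1-e*c∣≤1/6 : (e : ℚ) .{{_ : NonNegative e}} (t c : ℕ) → e *ℚ toℚ t ≡ ℤ.+ 1 / 6 →
  5 * t ≤ c → c ≤ 7 * t → ∣ 1ℚ -ℚ e *ℚ toℚ c ∣ ≤ℚ ℤ.+ 1 / 6
∣1-e*c∣≤1/6 e t c e*t≡1/6 5t≤c c≤7t = -q≤p≤q⇒∣p∣≤q
  (ℚ.+-monoʳ-≤ 1ℚ (ℚ.neg-antimono-≤ e*c≤7/6))
  (ℚ.+-monoʳ-≤ 1ℚ (ℚ.neg-antimono-≤ 5/6≤e*c))
  where
  open +-*-Solver
  scaled : (k : ℕ) → e *ℚ toℚ (k * t) ≡ toℚ k *ℚ (ℤ.+ 1 / 6)
  scaled k = begin
    e *ℚ toℚ (k * t)          ≡⟨ cong (e *ℚ_) (toℚ-* k t) ⟩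
    e *ℚ (toℚ k *ℚ toℚ t)     ≡⟨ solve 3 (λ x y z → x :* (y :* z) := y :* (x :* z)) refl e (toℚ k) (toℚ t) ⟩
    toℚ k *ℚ (e *ℚ toℚ t)     ≡⟨ cong (toℚ k *ℚ_) e*t≡1/6 ⟩
    toℚ k *ℚ (ℤ.+ 1 / 6)      ∎
    where open ≡-Reasoning
  e*c≤7/6 : e *ℚ toℚ c ≤ℚ toℚ 7 *ℚ (ℤ.+ 1 / 6)
  e*c≤7/6 = subst (e *ℚ toℚ c ≤ℚ_) (scaled 7) (ℚ.*-monoˡ-≤-nonNeg e (toℚ-mono-≤ c≤7t))
  5/6≤e*c : toℚ 5 *ℚ (ℤ.+ 1 / 6) ≤ℚ e *ℚ toℚ c
  5/6≤e*c = subst (_≤ℚ e *ℚ toℚ c) (scaled 5) (ℚ.*-monoˡ-≤-nonNeg e (toℚ-mono-≤ 5t≤c))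

bitℚ-not : (b : Bool) → bitℚ (not b) ≡ 1ℚ -ℚ bitℚ b
bitℚ-not true = refl
bitℚ-not false = refl

scaledXorVar : {m : ℕ} → ℚ → Fin m → Bool → Poly m
scaledXorVar a v false = (a , v ∷ []) ∷ []
scaledXorVar a v true = (a , []) ∷ (- a , v ∷ []) ∷ []

evalPoly-scaledXorVar : {m : ℕ} (a : ℚ) (v : Fin m) (c : Bool) (y : Bits m) →
  evalPoly (scaledXorVar a v c) y ≡ a *ℚ bitℚ (lookup y v xor c)
evalPoly-scaledXorVar a v false y = begin
  a *ℚ (bitℚ (lookup y v) *ℚ 1ℚ) +ℚ 0ℚ
    ≡⟨ solve 2 (λ a b → a :* (b :* con 1ℚ) :+ con 0ℚ := a :* b) refl a (bitℚ (lookup y v)) ⟩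
  a *ℚ bitℚ (lookup y v)                 ≡⟨ cong (λ b → a *ℚ bitℚ b) (xor-identityʳ (lookup y v)) ⟨
  a *ℚ bitℚ (lookup y v xor false)       ∎
  where
  open ≡-Reasoning
  open +-*-Solver
evalPoly-scaledXorVar a v true y = begin
  a *ℚ 1ℚ +ℚ (- a *ℚ (bitℚ (lookup y v) *ℚ 1ℚ) +ℚ 0ℚ)
    ≡⟨ solve 2 (λ a b → a :* con 1ℚ :+ (:- a :* (b :* con 1ℚ) :+ con 0ℚ) := a :* (con 1ℚ :- b))
               refl a (bitℚ (lookup y v)) ⟩
  a *ℚ (1ℚ -ℚ bitℚ (lookup y v))    ≡⟨ cong (a *ℚ_) (bitℚ-not (lookup y v)) ⟨
  a *ℚ bitℚ (not (lookup y v))      ≡⟨ cong (λ b → a *ℚ bitℚ b) (xor-comm (lookup y v) true) ⟨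
  a *ℚ bitℚ (lookup y v xor true)   ∎
  where
  open ≡-Reasoning
  open +-*-Solver

degree-scaledXorVar : {m : ℕ} (a : ℚ) (v : Fin m) (c : Bool) → DegLE4 (scaledXorVar a v c)
degree-scaledXorVar a v false = s≤s z≤n ∷ []
degree-scaledXorVar a v true = z≤n ∷ s≤s z≤n ∷ []

∑P : {M m : ℕ} → (Fin M → Poly m) → Poly m
∑P {zero} f = []
∑P {suc M} f = f zero ++ ∑P (f ∘ suc)

evalPoly-++ : {m : ℕ} (p p' : Poly m) (y : Bits m) → evalPoly (p ++ p') y ≡ evalPoly p y +ℚ evalPoly p' y
evalPoly-++ [] p' y = sym (ℚ.+-identityˡ _)
evalPoly-++ ((a , js) ∷ p) p' y =
  trans (cong (a *ℚ evalMono y js +ℚ_) (evalPoly-++ p p' y)) (sym (ℚ.+-assoc (a *ℚ evalMono y js) (evalPoly p y) (evalPoly p' y)))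

evalPoly-∑P : {M m : ℕ} (f : Fin M → Poly m) (y : Bits m) (a : ℚ) (g : Fin M → Bool) →
  (∀ j → evalPoly (f j) y ≡ a *ℚ bitℚ (g j)) → evalPoly (∑P f) y ≡ a *ℚ toℚ (count g)
evalPoly-∑P {zero} f y a g _ = sym (ℚ.*-zeroʳ a)
evalPoly-∑P {suc M} f y a g f≡a*g = begin
  evalPoly (f zero ++ ∑P (f ∘ suc)) y                    ≡⟨ evalPoly-++ (f zero) _ y ⟩
  evalPoly (f zero) y +ℚ evalPoly (∑P (f ∘ suc)) y
    ≡⟨ cong₂ _+ℚ_ (f≡a*g zero) (evalPoly-∑P (f ∘ suc) y a (g ∘ suc) (f≡a*g ∘ suc)) ⟩
  a *ℚ bitℚ (g zero) +ℚ a *ℚ toℚ (count (g ∘ suc))      ≡⟨ ℚ.*-distribˡ-+ a _ _ ⟨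
  a *ℚ (bitℚ (g zero) +ℚ toℚ (count (g ∘ suc)))
    ≡⟨ cong (λ b → a *ℚ (b +ℚ toℚ (count (g ∘ suc)))) (bitℚ≡toℚ (g zero)) ⟩
  a *ℚ (toℚ (if g zero then 1 else 0) +ℚ toℚ (count (g ∘ suc))) ≡⟨ cong (a *ℚ_) (toℚ-+ (if g zero then 1 else 0) _) ⟨
  a *ℚ toℚ (count g)                                       ∎
  where
  open ≡-Reasoning
  bitℚ≡toℚ : ∀ b → bitℚ b ≡ toℚ (if b then 1 else 0)
  bitℚ≡toℚ true = refl
  bitℚ≡toℚ false = refl

degree-∑P : {M m : ℕ} (f : Fin M → Poly m) → (∀ j → DegLE4 (f j)) → DegLE4 (∑P f)
degree-∑P {zero} f _ = []
degree-∑P {suc M} f deg = ++⁺ (deg zero) (degree-∑P (f ∘ suc) (deg ∘ suc))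

^-distribʳ-* : (a b k : ℕ) → (a * b) ^ k ≡ a ^ k * b ^ k
^-distribʳ-* a b zero = refl
^-distribʳ-* a b (suc k) = trans (cong (a * b *_) (^-distribʳ-* a b k)) (*-interchange a b (a ^ k) (b ^ k))

^-*-^-mono : (α β : ℕ) {k l a b : ℕ} → α ≤ β → a ≤ k → a + b ≡ k + l → α ^ k * β ^ l ≤ α ^ a * β ^ b
^-*-^-mono α β {k} {l} {a} {b} α≤β a≤k a+b≡k+l = begin
  α ^ k * β ^ l             ≡⟨ cong (λ e → α ^ e * β ^ l) (m+[n∸m]≡n a≤k) ⟨
  α ^ (a + d) * β ^ l       ≡⟨ cong (_* β ^ l) (^-distribˡ-+-* α a d) ⟩
  α ^ a * α ^ d * β ^ l     ≡⟨ *-assoc (α ^ a) (α ^ d) (β ^ l) ⟩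
  α ^ a * (α ^ d * β ^ l)   ≤⟨ *-monoʳ-≤ (α ^ a) (*-monoˡ-≤ (β ^ l) (^-monoˡ-≤ d α≤β)) ⟩
  α ^ a * (β ^ d * β ^ l)   ≡⟨ cong (α ^ a *_) (^-distribˡ-+-* β d l) ⟨
  α ^ a * β ^ (d + l)       ≡⟨ cong (λ e → α ^ a * β ^ e) d+l≡b ⟩
  α ^ a * β ^ b             ∎
  where
  open ≤-Reasoning
  d = k ∸ a
  d+l≡b : d + l ≡ b
  d+l≡b = +-cancelˡ-≡ a (d + l) b (trans (sym (+-assoc a d l)) (trans (cong (_+ l) (m+[n∸m]≡n a≤k)) (sym a+b≡k+l)))

6n[n+1]<4^n : (n : ℕ) → 4 ≤ n → 6 * (n * suc n) < 4 ^ n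
6n[n+1]<4^n n 4≤n = subst (λ n → 6 * (n * suc n) < 4 ^ n) (m+[n∸m]≡n 4≤n) (from4 (n ∸ 4))
  where
  from4 : (k : ℕ) → 6 * ((4 + k) * suc (4 + k)) < 4 ^ (4 + k)
  from4 zero = ≤ᵇ⇒≤ _ _ _
  from4 (suc k) = begin-strict
    6 * (suc m * suc (suc m))   ≤⟨ *-monoʳ-≤ 6 (*-monoʳ-≤ (suc m) m+2≤4m) ⟩
    6 * (suc m * (4 * m))       ≡⟨ regroup m ⟩
    4 * (6 * (m * suc m))       <⟨ *-monoʳ-< 4 (from4 k) ⟩
    4 * 4 ^ m                   ∎
    where
    open ≤-Reasoning
    m = 4 + k
    regroup : ∀ m → 6 * (suc m * (4 * m)) ≡ 4 * (6 * (m * suc m))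
    regroup = solve-∀
    m+2≤4m : suc (suc m) ≤ 4 * m
    m+2≤4m = ≤-trans (m≤m+n (6 + k) (3 * k + 10)) (≤-reflexive (expand k))
      where
      expand : ∀ k → (6 + k) + (3 * k + 10) ≡ 4 * (4 + k)
      expand = solve-∀

-- 6^12 / (5^5 7^7) ≈ 0.846, and 0.846^13 < 1/8.
union-bound-small : (n : ℕ) → 4 ≤ n →
  6 * (n * suc n) * 2 ^ n * 6 ^ (12 * (13 * n)) < 5 ^ (5 * (13 * n)) * 7 ^ (7 * (13 * n))
union-bound-small n 4≤n = begin-strict
  6 * (n * suc n) * 2 ^ n * 6 ^ (12 * (13 * n)) ≡⟨ cong (6 * (n * suc n) * 2 ^ n *_) 6^[12*13n]≡S^n ⟩
  6 * (n * suc n) * 2 ^ n * S ^ n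
    <⟨ *-monoˡ-< (S ^ n) {{m^n≢0 S n}} (*-monoˡ-< (2 ^ n) {{m^n≢0 2 n}} (6n[n+1]<4^n n 4≤n)) ⟩
  4 ^ n * 2 ^ n * S ^ n                        ≡⟨ cong (_* S ^ n) (^-distribʳ-* 4 2 n) ⟨
  8 ^ n * S ^ n                                ≡⟨ ^-distribʳ-* 8 S n ⟨
  (8 * S) ^ n                                  ≤⟨ ^-monoˡ-≤ n (≤ᵇ⇒≤ (8 * S) R _) ⟩
  R ^ n                                        ≡⟨ ^-*-assoc (5 ^ 5 * 7 ^ 7) 13 n ⟩
  (5 ^ 5 * 7 ^ 7) ^ (13 * n)                   ≡⟨ ^-distribʳ-* (5 ^ 5) (7 ^ 7) (13 * n) ⟩
  (5 ^ 5) ^ (13 * n) * (7 ^ 7) ^ (13 * n)      ≡⟨ cong₂ _*_ (^-*-assoc 5 5 (13 * n)) (^-*-assoc 7 7 (13 * n)) ⟩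
  5 ^ (5 * (13 * n)) * 7 ^ (7 * (13 * n))      ∎
  where
  open ≤-Reasoning
  S = (6 ^ 12) ^ 13
  R = (5 ^ 5 * 7 ^ 7) ^ 13
  6^[12*13n]≡S^n : 6 ^ (12 * (13 * n)) ≡ S ^ n
  6^[12*13n]≡S^n = trans (sym (^-*-assoc 6 12 (13 * n))) (sym (^-*-assoc (6 ^ 12) 13 n))

module Templates (n : ℕ) where

  t M K m' : ℕ
  t = 13 * n
  M = 12 * t
  K = n * suc n
  m' = K * M

  -- Block b = combine i ℓ of the base consists of M copies of the template with ones at positions i, …, i+ℓ-1.
  τ : Fin K → Bits n
  τ b = window n (toℕ (quotient {n} (suc n) b)) (toℕ (remainder {n} (suc n) b))

  block : Fin m' → Fin K
  block = quotient M

  block-combine : (b : Fin K) (j : Fin M) → block (combine b j) ≡ b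
  block-combine b j = cong proj₁ (remQuot-combine b j)

  ts : Vec (Bits n) m'
  ts = tabulate (τ ∘ block)

  E : List (Vec (Bits n) m')
  E = allVecs (λ p → listR (lookup ts p))

  ∈-E : (v : Vec (Bits n) m') → (∀ p → InR (lookup ts p) (lookup v p)) → v ∈ E
  ∈-E v v∈R = ∈-allVecs⁺ _ v (λ p → ∈-listR⁺ (lookup ts p) (lookup v p) (v∈R p))

  allBits : List (Bits n)
  allBits = listR (replicate n true)

  hits : Fin K → Bits n → Vec (Bits n) m' → Fin M → Bool
  hits b z v j = dot (lookup v (combine b j)) z

  deviates : Fin K → Bits n → Vec (Bits n) m' → Bool
  deviates b z v = meets (τ b) z ∧ ((count (hits b z v) <ᵇ 5 * t) ∨ (7 * t <ᵇ count (hits b z v)))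

  fails : Vec (Bits n) m' → Bool
  fails v = any (λ b → any (λ z → deviates b z v) allBits) (allFin K)

  ∏-block : (b : Fin K) (f : Fin m' → ℕ) →
    ∏ (λ p → if does (block p ≟ᶠ b) then f p else 1) ≡ ∏ (λ j → f (combine b j))
  ∏-block b f = begin
    ∏ (λ p → if does (block p ≟ᶠ b) then f p else 1)
      ≡⟨ ∏-combine K M (λ p → if does (block p ≟ᶠ b) then f p else 1) ⟩
    ∏ {K} (λ b' → ∏ {M} (λ j → if does (block (combine b' j) ≟ᶠ b) then f (combine b' j) else 1))
      ≡⟨ ∏-cong {K} (λ b' → ∏-cong {M} (λ j →
           cong (λ c → if does (c ≟ᶠ b) then f (combine b' j) else 1) (block-combine b' j))) ⟩
    ∏ {K} (λ b' → ∏ {M} (λ j → if does (b' ≟ᶠ b) then f (combine b' j) else 1))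
      ≡⟨ ∏-cong {K} (λ b' → ∏-if (does (b' ≟ᶠ b)) (λ j → f (combine b' j))) ⟩
    ∏ {K} (λ b' → if does (b' ≟ᶠ b) then ∏ (λ j → f (combine b' j)) else 1)
      ≡⟨ ∏-at b (λ b' → ∏ (λ j → f (combine b' j))) ⟩
    ∏ (λ j → f (combine b j)) ∎
    where open ≡-Reasoning

  -- The exponential moments α^{#hits} β^{#misses} of block b, written as products over all coordinates.
  weight : Fin K → ℕ → ℕ → Bits n → Fin m' → Bits n → ℕ
  weight b α β z p a = if does (block p ≟ᶠ b) then (if dot a z then α else β) else 1

  blockWeight : Fin K → ℕ → ℕ → Bits n → Vec (Bits n) m' → ℕ
  blockWeight b α β z v = ∏ (λ p → weight b α β z p (lookup v p))

  blockWeight-count : (b : Fin K) (α β : ℕ) (z : Bits n) (v : Vec (Bits n) m') →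
    blockWeight b α β z v ≡ α ^ count (hits b z v) * β ^ count (not ∘ hits b z v)
  blockWeight-count b α β z v =
    trans (∏-block b (λ p → if dot (lookup v p) z then α else β)) (∏-if-count (hits b z v) α β)

  sum-blockWeight : (b : Fin K) (α β : ℕ) (z : Bits n) → α + β ≡ 12 → T (meets (τ b) z) →
    sum (map (blockWeight b α β z) E) ≡ 6 ^ M * length E
  sum-blockWeight b α β z α+β≡12 τ∩z≠∅ = begin
    sum (map (blockWeight b α β z) E)
      ≡⟨ sum-∏-allVecs (weight b α β z) (λ p → listR (lookup ts p)) ⟩
    ∏ (λ p → sum (map (weight b α β z p) (listR (lookup ts p))))
      ≡⟨ ∏-cong per-coordinate ⟩
    ∏ (λ p → (if does (block p ≟ᶠ b) then 6 else 1) * length (listR (lookup ts p)))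
      ≡⟨ ∏-distrib-* (λ p → if does (block p ≟ᶠ b) then 6 else 1) (λ p → length (listR (lookup ts p))) ⟩
    ∏ (λ p → if does (block p ≟ᶠ b) then 6 else 1) * ∏ (λ p → length (listR (lookup ts p)))
      ≡⟨ cong₂ _*_ (trans (∏-block b (λ _ → 6)) (∏-const M 6)) (sym (length-allVecs (λ p → listR (lookup ts p)))) ⟩
    6 ^ M * length E ∎
    where
    open ≡-Reasoning
    per-coordinate : ∀ p → sum (map (weight b α β z p) (listR (lookup ts p)))
                           ≡ (if does (block p ≟ᶠ b) then 6 else 1) * length (listR (lookup ts p))
    per-coordinate p with block p ≟ᶠ b
    ... | no _ = sum-map-const 1 (listR (lookup ts p))
    ... | yes block-p≡b = *-cancelˡ-≡ _ _ 2 (begin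
      2 * sum (map (λ a → if dot a z then α else β) (listR (lookup ts p)))
        ≡⟨ sum-listR-balanced (λ d → if d then α else β) (lookup ts p) z
             (subst (λ τ' → T (meets τ' z)) (sym (trans (lookup∘tabulate (τ ∘ block) p) (cong τ block-p≡b))) τ∩z≠∅) ⟩
      (α + β) * length (listR (lookup ts p))
        ≡⟨ cong (_* length (listR (lookup ts p))) α+β≡12 ⟩
      12 * length (listR (lookup ts p))
        ≡⟨ *-assoc 2 6 (length (listR (lookup ts p))) ⟩
      2 * (6 * length (listR (lookup ts p))) ∎)

  -- The least value of 5^c 7^(M-c) for c ≤ 5t, and of 7^c 5^(M-c) for c ≥ 7t.
  D : ℕ
  D = 5 ^ (5 * t) * 7 ^ (7 * t)

  hits+misses : (b : Fin K) (z : Bits n) (v : Vec (Bits n) m') → count (hits b z v) + count (not ∘ hits b z v) ≡ 5 * t + 7 * t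
  hits+misses b z v = trans (count+count-not (hits b z v)) (*-distribʳ-+ t 5 7)

  deviates⇒weight : (b : Fin K) (z : Bits n) (v : Vec (Bits n) m') → T (deviates b z v) →
    D ≤ blockWeight b 5 7 z v + blockWeight b 7 5 z v
  deviates⇒weight b z v dev with Equivalence.to T-∨ (proj₂ (Equivalence.to T-∧ dev))
  ... | inj₁ low = ≤-trans (subst (D ≤_) (sym (blockWeight-count b 5 7 z v))
                      (^-*-^-mono 5 7 (m≤m+n 5 2) (<⇒≤ (<ᵇ⇒< (count (hits b z v)) (5 * t) low)) (hits+misses b z v)))
                    (m≤m+n _ _)
  ... | inj₂ high = ≤-trans (subst (D ≤_) (sym (trans (blockWeight-count b 7 5 z v) (*-comm (7 ^ c) (5 ^ c'))))
                      (^-*-^-mono 5 7 (m≤m+n 5 2) c'≤5t (trans (+-comm c' c) (hits+misses b z v))))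
                     (m≤n+m _ _)
    where
    c = count (hits b z v)
    c' = count (not ∘ hits b z v)
    c'≤5t : c' ≤ 5 * t
    c'≤5t = +-cancelˡ-≤ (7 * t) c' (5 * t) (≤-trans (+-monoˡ-≤ c' (<⇒≤ (<ᵇ⇒< (7 * t) c high)))
              (≤-reflexive (trans (hits+misses b z v) (+-comm (5 * t) (7 * t)))))

  count-deviates : (b : Fin K) (z : Bits n) → length (filterᵇ (deviates b z) E) * D ≤ 2 * (6 ^ M * length E)
  count-deviates b z with T? (meets (τ b) z)
  ... | no τ∩z=∅ =
    ≤-trans (length-filterᵇ-* (deviates b z) (λ _ → 0) E never) (≤-trans (≤-reflexive (sum-map-const 0 E)) z≤n)
    where
    never : ∀ v → T (deviates b z v) → D ≤ 0
    never v dev = ⊥-elim (τ∩z=∅ (proj₁ (Equivalence.to T-∧ dev)))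
  ... | yes τ∩z = begin
    length (filterᵇ (deviates b z) E) * D
      ≤⟨ length-filterᵇ-* (deviates b z) (λ v → blockWeight b 5 7 z v + blockWeight b 7 5 z v) E (deviates⇒weight b z) ⟩
    sum (map (λ v → blockWeight b 5 7 z v + blockWeight b 7 5 z v) E)
      ≡⟨ sum-map-+ (blockWeight b 5 7 z) (blockWeight b 7 5 z) E ⟩
    sum (map (blockWeight b 5 7 z) E) + sum (map (blockWeight b 7 5 z) E)
      ≡⟨ cong₂ _+_ (sum-blockWeight b 5 7 z refl τ∩z) (sum-blockWeight b 7 5 z refl τ∩z) ⟩
    6 ^ M * length E + 6 ^ M * length E
      ≡⟨ cong (6 ^ M * length E +_) (+-identityʳ _) ⟨
    2 * (6 ^ M * length E) ∎
    where open ≤-Reasoning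

  length-allBits : length allBits ≡ 2 ^ n
  length-allBits = trans (length-listR (replicate n true)) (cong (2 ^_) (ones-replicate n))
    where
    ones-replicate : (k : ℕ) → ones (replicate k true) ≡ k
    ones-replicate zero = refl
    ones-replicate (suc k) = cong suc (ones-replicate k)

  count-fails : length (filterᵇ fails E) * D ≤ K * (2 ^ n * (2 * (6 ^ M * length E)))
  count-fails = begin
    length (filterᵇ fails E) * D
      ≤⟨ length-filterᵇ-any-* (λ b v → any (λ z → deviates b z v) allBits) (allFin K) E
           (λ b → length-filterᵇ-any-* (λ z v → deviates b z v) allBits E (count-deviates b)) ⟩
    length (allFin K) * (length allBits * (2 * (6 ^ M * length E)))
      ≡⟨ cong₂ (λ a c → a * (c * (2 * (6 ^ M * length E)))) (length-tabulate {n = K} (λ b → b)) length-allBits ⟩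
    K * (2 ^ n * (2 * (6 ^ M * length E))) ∎
    where open ≤-Reasoning

  length-E : length E ≡ baseSize ts
  length-E = trans (length-allVecs (λ p → listR (lookup ts p))) (trans (∏-cong (λ p → length-listR (lookup ts p))) (∏-2^ones ts))
    where
    ∏-2^ones : {m : ℕ} (us : Vec (Bits n) m) → ∏ (λ p → 2 ^ ones (lookup us p)) ≡ baseSize us
    ∏-2^ones [] = refl
    ∏-2^ones (u ∷ us) = cong (2 ^ ones u *_) (∏-2^ones us)

module Construction (n : ℕ) where
  open Templates n public

  units : Vec (Bits n) n
  units = tabulate unit

  windowIndex : Fin n → List Bool → Fin K
  windowIndex i s = combine i (length s mod suc n)

  coordinate : Fin K → Fin M → Fin (n + m')
  coordinate b j = n ↑ʳ combine b j

  e : ℚ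
  e = recip (6 * t)

  qTerm : Vec (Bits n) (n + m') → Fin n → List Bool → Fin M → Poly (n + m')
  qTerm r i s j = scaledXorVar (- e) c (dot (lookup r c) (placeAt n (toℕ i) s))
    where c = coordinate (windowIndex i s) j

  q : Vec (Bits n) (n + m') → Fin n → List Bool → Poly (n + m')
  q r i s = (1ℚ , []) ∷ ∑P (qTerm r i s)

  degree-q : (r : Vec (Bits n) (n + m')) (i : Fin n) (s : List Bool) → DegLE4 (q r i s)
  degree-q r i s = z≤n ∷ degree-∑P (qTerm r i s) (λ j → degree-scaledXorVar (- e) _ _)

  evalPoly-q : (v : Vec (Bits n) m') (i : Fin n) (s : List Bool) (x : Bits n) →
    evalPoly (q (units Vec.++ v) i s) (Y (units Vec.++ v) x)
      ≡ 1ℚ -ℚ e *ℚ toℚ (count (hits (windowIndex i s) (x ⊕ placeAt n (toℕ i) s) v))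
  evalPoly-q v i s x = trans (cong (1ℚ *ℚ 1ℚ +ℚ_) (evalPoly-∑P (qTerm r i s) (Y r x) (- e) (hits b (x ⊕ sp) v) term))
    (solve 2 (λ e c → con 1ℚ :* con 1ℚ :+ (:- e) :* c := con 1ℚ :- e :* c) refl e _)
    where
    open +-*-Solver
    r = units Vec.++ v
    b = windowIndex i s
    sp = placeAt n (toℕ i) s
    term : ∀ j → evalPoly (qTerm r i s j) (Y r x) ≡ (- e) *ℚ bitℚ (hits b (x ⊕ sp) v j)
    term j = trans (evalPoly-scaledXorVar (- e) (coordinate b j) _ (Y r x)) (cong (λ d → (- e) *ℚ bitℚ d) (begin
      lookup (Y r x) (coordinate b j) xor dot (lookup r (coordinate b j)) sp
        ≡⟨ cong (_xor dot (lookup r (coordinate b j)) sp) (lookup-map (coordinate b j) (λ rj → dot rj x) r) ⟩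
      dot (lookup r (coordinate b j)) x xor dot (lookup r (coordinate b j)) sp
        ≡⟨ dot-⊕ (lookup r (coordinate b j)) x sp ⟨
      dot (lookup r (coordinate b j)) (x ⊕ sp)
        ≡⟨ cong (λ a → dot a (x ⊕ sp)) (lookup-++ʳ units v (combine b j)) ⟩
      hits b (x ⊕ sp) v j ∎))
      where open ≡-Reasoning

  τ-windowIndex : (i : Fin n) (s : List Bool) → length s ≤ n → τ (windowIndex i s) ≡ window n (toℕ i) (length s)
  τ-windowIndex i s |s|≤n = begin
    τ (combine i (length s mod suc n))
      ≡⟨ cong (λ ic → window n (toℕ (proj₁ ic)) (toℕ (proj₂ ic))) (remQuot-combine i (length s mod suc n)) ⟩
    window n (toℕ i) (toℕ (length s mod suc n))
      ≡⟨ cong (window n (toℕ i)) (trans (toℕ-fromℕ< (m%n<n (length s) (suc n))) (m≤n⇒m%n≡m |s|≤n)) ⟩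
    window n (toℕ i) (length s) ∎
    where open ≡-Reasoning

  InR-block : (v : Vec (Bits n) m') → (∀ p → InR (lookup ts p) (lookup v p)) →
    (b : Fin K) (j : Fin M) → InR (τ b) (lookup v (combine b j))
  InR-block v v∈R b j = subst (λ τ' → InR τ' (lookup v (combine b j)))
    (trans (lookup∘tabulate (τ ∘ block) (combine b j)) (cong τ (block-combine b j))) (v∈R (combine b j))

  deviates-if-far : .{{_ : NonZero n}} (v : Vec (Bits n) m') → (∀ p → InR (lookup ts p) (lookup v p)) →
    (b : Fin K) (z : Bits n) →
    ℤ.+ 1 / 6 <ℚ ∣ (1ℚ -ℚ e *ℚ toℚ (count (hits b z v))) -ℚ bitℚ (not (meets (τ b) z)) ∣ →
    T (deviates b z v)
  deviates-if-far v v∈R b z far with meets (τ b) z in τ∩z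
  ... | false = ⊥-elim (ℚ.<-asym (subst (λ w → ℤ.+ 1 / 6 <ℚ ∣ w ∣) exact far) (ℚ.positive⁻¹ (ℤ.+ 1 / 6)))
    where
    open +-*-Solver
    no-hits : count (hits b z v) ≡ 0
    no-hits = count-false (hits b z v) (λ j → dot-disjoint (τ b) (lookup v (combine b j)) z (InR-block v v∈R b j) (subst T τ∩z))
    exact : (1ℚ -ℚ e *ℚ toℚ (count (hits b z v))) -ℚ 1ℚ ≡ 0ℚ
    exact = trans (cong (λ c → (1ℚ -ℚ e *ℚ toℚ c) -ℚ 1ℚ) no-hits)
      (solve 1 (λ e → (con 1ℚ :- e :* con 0ℚ) :- con 1ℚ := con 0ℚ) refl e)
  ... | true with T? ((count (hits b z v) <ᵇ 5 * t) ∨ (7 * t <ᵇ count (hits b z v)))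
  ...   | yes outside = outside
  ...   | no inside = ⊥-elim (ℚ.<-irrefl refl (ℚ.<-≤-trans (subst (λ w → ℤ.+ 1 / 6 <ℚ ∣ w ∣) (ℚ.+-identityʳ _) far)
                         (∣1-e*c∣≤1/6 e {{recip-nonNeg (6 * t)}} t c (recip-6*-* t {{m*n≢0 13 n}}) 5t≤c c≤7t)))
    where
    c = count (hits b z v)
    5t≤c : 5 * t ≤ c
    5t≤c = ≮⇒≥ (λ c<5t → inside (Equivalence.from T-∨ (inj₁ (<⇒<ᵇ c<5t))))
    c≤7t : c ≤ 7 * t
    c≤7t = ≮⇒≥ (λ 7t<c → inside (Equivalence.from T-∨ (inj₂ (<⇒<ᵇ 7t<c))))

  ∈-allBits : (z : Bits n) → z ∈ allBits
  ∈-allBits z = ∈-listR⁺ (replicate n true) z never-false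
    where
    never-false : InR (replicate n true) z
    never-false k ones≡false with () ← trans (sym (lookup-replicate k true)) ones≡false

  bad⇒fails : .{{_ : NonZero n}} (v : Vec (Bits n) m') → (∀ p → InR (lookup ts p) (lookup v p)) →
    Bad q (units Vec.++ v) → T (fails v)
  bad⇒fails v v∈R (i , x , s , |s|≤ , far) =
    any⁺ _ (lose (∈-allFin b) (any⁺ _ (lose (∈-allBits z) (deviates-if-far v v∈R b z far'))))
    where
    b = windowIndex i s
    z = x ⊕ placeAt n (toℕ i) s
    phi≡ : phi x (toℕ i) s ≡ not (meets (τ b) z)
    phi≡ = trans (phi-window n (toℕ i) x s |s|≤)
      (cong (λ τ' → not (meets τ' z)) (sym (τ-windowIndex i s (≤-trans |s|≤ (m∸n≤m n (toℕ i))))))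
    far' : ℤ.+ 1 / 6 <ℚ ∣ (1ℚ -ℚ e *ℚ toℚ (count (hits b z v))) -ℚ bitℚ (not (meets (τ b) z)) ∣
    far' = subst₂ (λ w φ → ℤ.+ 1 / 6 <ℚ ∣ w -ℚ bitℚ φ ∣) (evalPoly-q v i s x) phi≡ far

  InBase⇒units++ : (r : Vec (Bits n) (n + m')) → InBase ts r →
    Σ (Vec (Bits n) m') λ v → (r ≡ units Vec.++ v) × (∀ p → InR (lookup ts p) (lookup v p))
  InBase⇒units++ r (r-units , r-R) with splitAt n r
  ... | us , v , r≡us++v = v , trans r≡us++v (cong (Vec._++ v) us≡units) , v∈R
    where
    us≡units : us ≡ units
    us≡units = trans (sym (tabulate∘lookup us)) (tabulate-cong λ j →
      trans (sym (lookup-++ˡ us v j)) (trans (cong (λ w → lookup w (j ↑ˡ m')) (sym r≡us++v)) (r-units j)))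
    v∈R : ∀ p → InR (lookup ts p) (lookup v p)
    v∈R p = subst (InR (lookup ts p)) (trans (cong (λ w → lookup w (n ↑ʳ p)) r≡us++v) (lookup-++ʳ us v p)) (r-R p)

  L : List (Vec (Bits n) (n + m'))
  L = map (units Vec.++_) (filterᵇ fails E)

  bad∈L : .{{_ : NonZero n}} (r : Vec (Bits n) (n + m')) → InBase ts r → Bad q r → r ∈ L
  bad∈L r r∈base bad with InBase⇒units++ r r∈base
  ... | v , refl , v∈R = ∈-map⁺ (units Vec.++_) (∈-filter⁺ (T? ∘ fails) (∈-E v v∈R) (bad⇒fails v v∈R bad))

  few-bad : 4 ≤ n → 3 * length L < baseSize ts
  few-bad 4≤n = subst₂ (λ a c → 3 * a < c) (sym (length-map (units Vec.++_) (filterᵇ fails E))) length-E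
    (*-cancelʳ-< D (3 * ℓ) (length E) (begin-strict
      3 * ℓ * D                                     ≡⟨ *-assoc 3 ℓ D ⟩
      3 * (ℓ * D)                                   ≤⟨ *-monoʳ-≤ 3 count-fails ⟩
      3 * (K * (2 ^ n * (2 * (6 ^ M * length E))))  ≡⟨ regroup K (2 ^ n) (6 ^ M) (length E) ⟩
      6 * K * 2 ^ n * 6 ^ M * length E              <⟨ *-monoˡ-< (length E) {{E≢0}} (union-bound-small n 4≤n) ⟩
      D * length E                                  ≡⟨ *-comm D (length E) ⟩
      length E * D                                  ∎))
    where
    open ≤-Reasoning
    ℓ = length (filterᵇ fails E)
    regroup : ∀ a b c d → 3 * (a * (b * (2 * (c * d)))) ≡ 6 * a * b * c * d
    regroup = solve-∀
    E≢0 : NonZero (length E)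
    E≢0 = subst NonZero (sym length-E) (baseSize≢0 ts)
      where
      baseSize≢0 : {m : ℕ} (us : Vec (Bits n) m) → NonZero (baseSize us)
      baseSize≢0 [] = _
      baseSize≢0 (u ∷ us) = m*n≢0 (2 ^ ones u) (baseSize us) {{m^n≢0 2 (ones u)}} {{baseSize≢0 us}}

size-bound : (n : ℕ) → 1 ≤ n → n + Templates.m' n ≤ 313 * n ^ 3
size-bound (suc k) _ = ≤-trans (m≤m+n _ (157 * (k * k * k) + 315 * (k * k) + 158 * k)) (≤-reflexive (expand k))
  where
  expand : ∀ k → (1 + k) + ((1 + k) * (2 + k)) * (12 * (13 * (1 + k))) + (157 * (k * k * k) + 315 * (k * k) + 158 * k)
                 ≡ 313 * ((1 + k) * ((1 + k) * ((1 + k) * 1)))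
  expand = solve-∀

claim4p1 : Σ ℕ λ C → Σ ℕ λ N → (n : ℕ) → N ≤ n →
    Σ ℕ λ m' → Σ (Vec (Bits n) m') λ ts →
    (n + m' ≤ C * n ^ 3) ×
    (Σ (Vec (Bits n) (n + m') → Fin n → List Bool → Poly (n + m')) λ q →
      ((r : Vec (Bits n) (n + m')) → (i : Fin n) → (s : List Bool) → DegLE4 (q r i s)) ×
      (Σ (List (Vec (Bits n) (n + m'))) λ L →
        ((r : Vec (Bits n) (n + m')) → InBase ts r → Bad q r → r ∈ L) ×
        (3 * length L < baseSize ts)))
claim4p1 = 313 , 4 , λ n 4≤n →
  let open Construction n
      instance n≢0 : NonZero n
               n≢0 = >-nonZero (≤-trans (s≤s z≤n) 4≤n)
  in m' , ts , size-bound n (>-nonZero⁻¹ n) , q , degree-q , L , bad∈L , few-bad 4≤n
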